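{- Let $q$ be a prime power, $n\ge1$, $\sigma$ a generator of $\mathrm{Gal}(\mathbb{F}_{q^n}/\mathbb{F}_q)$, and $L=ax+bx^{\sigma}+cx^{\sigma^2}+dx^{\sigma^3}$ with $a,b,c,d\in\mathbb{F}_{q^n}$, $d\neq0$ and $a\neq0$. Write the characteristic polynomial of $A_L$ as $x^3-\chi_2x^2+\chi_1x-\chi_0$. Then $L$ is a permutation polynomial of $\mathbb{F}_{q^n}$ if and only if $1-\chi_2+\chi_1-\chi_0\neq0$.
   Context: $C_L=\begin{pmatrix}0&0&-a/d\\1&0&-b/d\\0&1&-c/d\end{pmatrix}$ and $A_L=C_LC_L^{\sigma}\cdots C_L^{\sigma^{n-1}}$, where $C_L^{\sigma^i}$ denotes entrywise application of $\sigma^i$. A permutation polynomial is one inducing a bijection of $\mathbb{F}_{q^n}$. -}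

module Defs where

open import Level using (0ℓ)
open import Data.Nat using (ℕ; zero; suc; _<_)
open import Data.Nat.Primality using (Prime)
open import Data.Fin using (Fin; zero; suc)
open import Data.Product using (Σ; ∃; ∃-syntax; _×_; _,_; proj₁)
open import Data.List using (List; []; _∷_)
open import Relation.Nullary using (¬_)
open import Relation.Binary.Bundles using (Setoid)
import Relation.Binary.PropositionalEquality as ≡
open import Algebra.Bundles using (CommutativeRing)
open import Function.Definitions using (Injective; Surjective)
open import Function.Bundles using (Bijection)

record Field : Set₁ where
  field
    commRing : CommutativeRing 0ℓ 0ℓ
  open CommutativeRing commRing public
  field
    _⁻¹      : Carrier → Carrier
    inverseʳ : ∀ x → ¬ (x ≈ 0#) → x * (x ⁻¹) ≈ 1#
    0≉1      : ¬ (0# ≈ 1#)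

IsPrimePower : ℕ → Set
IsPrimePower q = ∃[ p ] ∃[ k ] (Prime p × q ≡.≡ p Data.Nat.^ suc k)

module _ (F : Field) where
  open Field F using (Carrier; _≈_; _+_; _*_; -_; _-_; 0#; 1#; _⁻¹; setoid; refl; sym; trans)

  HasCard : ℕ → Set
  HasCard N = Bijection (≡.setoid (Fin N)) setoid

  record IsAutomorphism (σ : Carrier → Carrier) : Set where
    field
      σ-cong : ∀ {x y} → x ≈ y → σ x ≈ σ y
      σ-+    : ∀ x y → σ (x + y) ≈ σ x + σ y
      σ-*    : ∀ x y → σ (x * y) ≈ σ x * σ y
      σ-1    : σ 1# ≈ 1#
      σ-inj  : Injective _≈_ _≈_ σ
      σ-surj : Surjective _≈_ _≈_ σ

  iter : (Carrier → Carrier) → ℕ → Carrier → Carrier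
  iter σ zero    x = x
  iter σ (suc k) x = σ (iter σ k x)

  FixedSetoid : (Carrier → Carrier) → Setoid 0ℓ 0ℓ
  FixedSetoid σ = record
    { Carrier = Σ Carrier (λ x → σ x ≈ x)
    ; _≈_ = λ u v → proj₁ u ≈ proj₁ v
    ; isEquivalence = record { refl = refl ; sym = sym ; trans = trans } }

  HasOrder : (Carrier → Carrier) → ℕ → Set
  HasOrder σ n = (∀ x → iter σ n x ≈ x)
               × (∀ k → 0 < k → k < n → ∃[ x ] ¬ (iter σ k x ≈ x))

  -- F has q^n elements and σ generates Gal(F / F_q), where F_q is the
  -- subfield with q elements: σ is an automorphism of order n whose fixed
  -- field is F_q (i.e. has exactly q elements).
  record IsGaloisGenerator (q n : ℕ) (σ : Carrier → Carrier) : Set where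
    field
      card      : HasCard (q Data.Nat.^ n)
      auto      : IsAutomorphism σ
      fixedCard : Bijection (≡.setoid (Fin q)) (FixedSetoid σ)
      order     : HasOrder σ n

  Mat3 : Set
  Mat3 = Fin 3 → Fin 3 → Carrier

  f0 f1 f2 : Fin 3
  f0 = zero
  f1 = suc zero
  f2 = suc (suc zero)

  _⊗_ : Mat3 → Mat3 → Mat3
  (M ⊗ N) i j = M i f0 * N f0 j + M i f1 * N f1 j + M i f2 * N f2 j

  I3 : Mat3
  I3 zero    zero    = 1#
  I3 (suc i) (suc j) = I3' i j
    where
    I3' : Fin 2 → Fin 2 → Carrier
    I3' zero    zero    = 1#
    I3' (suc _) (suc _) = 1#
    I3' _       _       = 0#
  I3 _       _       = 0#

  mapMat : (Carrier → Carrier) → Mat3 → Mat3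
  mapMat f M i j = f (M i j)

  C : (a b c d : Carrier) → Mat3
  C a b c d zero    zero    = 0#
  C a b c d zero    (suc zero) = 0#
  C a b c d zero    (suc (suc zero)) = - (a * d ⁻¹)
  C a b c d (suc zero) zero = 1#
  C a b c d (suc zero) (suc zero) = 0#
  C a b c d (suc zero) (suc (suc zero)) = - (b * d ⁻¹)
  C a b c d (suc (suc zero)) zero = 0#
  C a b c d (suc (suc zero)) (suc zero) = 1#
  C a b c d (suc (suc zero)) (suc (suc zero)) = - (c * d ⁻¹)

  prodFrom : (Carrier → Carrier) → Mat3 → ℕ → ℕ → Mat3
  prodFrom σ M i zero    = I3
  prodFrom σ M i (suc m) = mapMat (iter σ i) M ⊗ prodFrom σ M (suc i) m

  A : (σ : Carrier → Carrier) (n : ℕ) (a b c d : Carrier) → Mat3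
  A σ n a b c d = prodFrom σ (C a b c d) 0 n

  -- polynomials over F as coefficient lists (lowest degree first)
  Poly : Set
  Poly = List Carrier

  _+ₚ_ : Poly → Poly → Poly
  []       +ₚ g        = g
  (x ∷ f)  +ₚ []       = x ∷ f
  (x ∷ f)  +ₚ (y ∷ g)  = (x + y) ∷ (f +ₚ g)

  scaleₚ : Carrier → Poly → Poly
  scaleₚ c []      = []
  scaleₚ c (x ∷ f) = (c * x) ∷ scaleₚ c f

  _*ₚ_ : Poly → Poly → Poly
  []      *ₚ g = []
  (x ∷ f) *ₚ g = scaleₚ x g +ₚ (0# ∷ (f *ₚ g))

  -ₚ_ : Poly → Poly
  -ₚ f = scaleₚ (- 1#) f

  coeff : Poly → ℕ → Carrier
  coeff []      _       = 0#
  coeff (x ∷ f) zero    = x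
  coeff (x ∷ f) (suc k) = coeff f k

  det3ₚ : (Fin 3 → Fin 3 → Poly) → Poly
  det3ₚ P =
        (P f0 f0 *ₚ (P f1 f1 *ₚ P f2 f2))
    +ₚ ((P f0 f1 *ₚ (P f1 f2 *ₚ P f2 f0))
    +ₚ ((P f0 f2 *ₚ (P f1 f0 *ₚ P f2 f1))
    +ₚ ((-ₚ (P f0 f2 *ₚ (P f1 f1 *ₚ P f2 f0)))
    +ₚ ((-ₚ (P f0 f1 *ₚ (P f1 f0 *ₚ P f2 f2)))
    +ₚ  (-ₚ (P f0 f0 *ₚ (P f1 f2 *ₚ P f2 f1)))))))

  xI-M : Mat3 → Fin 3 → Fin 3 → Poly
  xI-M M i j = (- M i j) ∷ (I3 i j ∷ [])

  charPoly : Mat3 → Poly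
  charPoly M = det3ₚ (xI-M M)

  -- writing charPoly M = x³ − χ₂ x² + χ₁ x − χ₀
  χ₂ χ₁ χ₀ : Mat3 → Carrier
  χ₂ M = - coeff (charPoly M) 2
  χ₁ M = coeff (charPoly M) 1
  χ₀ M = - coeff (charPoly M) 0

  Lmap : (σ : Carrier → Carrier) (a b c d : Carrier) → Carrier → Carrier
  Lmap σ a b c d x = a * x + b * iter σ 1 x + c * iter σ 2 x + d * iter σ 3 x

  IsPermutation : (Carrier → Carrier) → Set
  IsPermutation f = Injective _≈_ _≈_ f × Surjective _≈_ _≈_ f

{-# OPTIONS --safe #-}
module Submission where

-- For a row vector w = (z, σz, σ²z), the equation L z = 0 is the twisted
-- eigen-equation w C = σ(w), where C is the companion matrix of L; iterating
-- it n times gives w A = w. So a nonzero root of L is a nonzero fixed vector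
-- of A, and 1 - χ₂ + χ₁ - χ₀ = det(I - A), which then vanishes. Conversely, if
-- det(I - A) = 0 the adjugate of I - A produces a nonzero fixed vector u of A,
-- and u descends to a nonzero solution of w C = σ(w): with τ = σ⁻¹ and
-- S w = τ(w C), the traces Σᵢ Sⁱ(x u) are S-fixed, and by Dedekind's
-- independence of the characters τⁱ they cannot all vanish. Finally an
-- injective map of a finite field to itself is onto.

open import Defs
open import Data.Nat using (ℕ; _≥_)
open import Data.Product using (_×_)
open import Function.Bundles using (_⇔_)
open import Relation.Nullary using (¬_)

open import Algebra.Bundles using (CommutativeRing)
open import Algebra.Bundles.Raw using (RawRing)
open import Data.Nat as ℕ using (zero; suc; s≤s; z≤n)
import Data.Nat.Properties as ℕ
open import Data.Fin as Fin using (Fin; toℕ)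
open import Data.Fin.Patterns using (0F; 1F; 2F)
import Data.Fin.Properties as Fin
open import Data.Maybe using (Maybe; just; nothing)
open import Data.List using (List; []; _∷_)
open import Data.Vec as Vec using (Vec; []; _∷_)
open import Data.Product using (∃; _,_; proj₁; proj₂)
open import Data.Empty using (⊥-elim)
open import Relation.Nullary using (yes; no)
open import Relation.Binary.Definitions using (tri<; tri≈; tri>)
open import Relation.Binary.PropositionalEquality as ≡ using (_≡_; _≢_)
open import Function.Definitions using (Injective; Surjective)
open import Function.Bundles using (Bijection; mk⇔)
open import Relation.Binary.Bundles using (Setoid)
import Relation.Binary.Reasoning.Setoid

-- Integer coefficients are represented as differences (m , n) of naturals.
module IntegerCoefficientSolver {c ℓ} (R : CommutativeRing c ℓ) where
  open CommutativeRing R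
  open import Algebra.Properties.Semiring.Mult semiring using (×-homo-+; ×1-homo-*; ×-congˡ) renaming (_×_ to _×′_)
  open import Algebra.Properties.Ring ring using (-0#≈0#; x[y-z]≈xy-xz; [y-z]x≈yx-zx)
  open import Algebra.Properties.AbelianGroup +-abelianGroup using (⁻¹-anti-homo‿-; ⁻¹-∙-comm)
  open import Algebra.Properties.CommutativeSemigroup +-commutativeSemigroup using (interchange; x∙yz≈yx∙z)
  open import Algebra.Properties.Group +-group using (x∙y⁻¹≈ε⇒x≈y; x≈y⇒x∙y⁻¹≈ε)
  open import Algebra.Solver.Ring.AlmostCommutativeRing using (fromCommutativeRing; _-Raw-AlmostCommutative⟶_)
  open import Relation.Binary.Reasoning.Setoid setoid
  open Data.Nat using () renaming (_+_ to _+ℕ_; _*_ to _*ℕ_)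

  private
    Difference : Set
    Difference = ℕ × ℕ

    -- 0 and 1 evaluate to 0# and 1# on the nose, so that the constants of
    -- solver expressions reduce to the ring's own constants.
    ⟦_⟧ᵈ : Difference → Carrier
    ⟦ 0 , 0 ⟧ᵈ = 0#
    ⟦ 1 , 0 ⟧ᵈ = 1#
    ⟦ m , n ⟧ᵈ = m ×′ 1# - n ×′ 1#

    ⟦⟧ᵈ-≈ : ∀ m n → ⟦ m , n ⟧ᵈ ≈ m ×′ 1# - n ×′ 1#
    ⟦⟧ᵈ-≈ 0 0             = sym (-‿inverseʳ 0#)
    ⟦⟧ᵈ-≈ 1 0             = sym (trans (+-congˡ -0#≈0#) (trans (+-identityʳ _) (+-identityʳ _)))
    ⟦⟧ᵈ-≈ 0 (suc n)       = refl
    ⟦⟧ᵈ-≈ 1 (suc n)       = refl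
    ⟦⟧ᵈ-≈ (suc (suc m)) n = refl

    -- Keeping differences reduced makes equal integers equal pairs, which is
    -- what the solver's normal forms are compared with.
    reduce : Difference → Difference
    reduce (suc m , suc n) = reduce (m , n)
    reduce d               = d

    -‿+-exchange : ∀ x y u v → (x + u) - (y + v) ≈ (x - y) + (u - v)
    -‿+-exchange x y u v = trans (+-congˡ (sym (⁻¹-∙-comm y v))) (interchange x u (- y) (- v))

    -‿cancel : ∀ x y u v → x + v ≈ u + y → x - y ≈ u - v
    -‿cancel x y u v x+v≈u+y = x∙y⁻¹≈ε⇒x≈y _ _ (begin
      (x - y) - (u - v)   ≈⟨ +-congˡ (⁻¹-anti-homo‿- u v) ⟩
      (x - y) + (v - u)   ≈⟨ -‿+-exchange x y v u ⟨
      (x + v) - (y + u)   ≈⟨ +-congˡ (-‿cong (+-comm y u)) ⟩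
      (x + v) - (u + y)   ≈⟨ x≈y⇒x∙y⁻¹≈ε x+v≈u+y ⟩
      0#                  ∎)

    [a-b][c-d] : ∀ a b c d → (a * c + b * d) - (a * d + b * c) ≈ (a - b) * (c - d)
    [a-b][c-d] a b c d = begin
      (a * c + b * d) - (a * d + b * c)   ≈⟨ -‿+-exchange _ _ _ _ ⟩
      (a * c - a * d) + (b * d - b * c)   ≈⟨ +-congˡ (⁻¹-anti-homo‿- _ _) ⟨
      (a * c - a * d) - (b * c - b * d)   ≈⟨ +-cong (x[y-z]≈xy-xz a c d) (-‿cong (x[y-z]≈xy-xz b c d)) ⟨
      a * (c - d) - b * (c - d)           ≈⟨ [y-z]x≈yx-zx (c - d) a b ⟨
      (a - b) * (c - d)                   ∎

    ⟦reduce⟧ : ∀ m n → ⟦ reduce (m , n) ⟧ᵈ ≈ ⟦ m , n ⟧ᵈ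
    ⟦reduce⟧ zero    n       = refl
    ⟦reduce⟧ (suc m) zero    = refl
    ⟦reduce⟧ (suc m) (suc n) = begin
      ⟦ reduce (m , n) ⟧ᵈ          ≈⟨ ⟦reduce⟧ m n ⟩
      ⟦ m , n ⟧ᵈ                   ≈⟨ ⟦⟧ᵈ-≈ m n ⟩
      m ×′ 1# - n ×′ 1#            ≈⟨ -‿cancel _ _ _ _ (x∙yz≈yx∙z _ 1# _) ⟩
      suc m ×′ 1# - suc n ×′ 1#    ≈⟨ ⟦⟧ᵈ-≈ (suc m) (suc n) ⟨
      ⟦ suc m , suc n ⟧ᵈ           ∎

    Coefficients : RawRing _ _
    Coefficients = record
      { Carrier = Difference
      ; _≈_     = _≡_
      ; _+_     = λ { (a , b) (c , d) → reduce (a +ℕ c , b +ℕ d) }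
      ; _*_     = λ { (a , b) (c , d) → reduce (a *ℕ c +ℕ b *ℕ d , a *ℕ d +ℕ b *ℕ c) }
      ; -_      = λ { (a , b) → (b , a) }
      ; 0#      = 0 , 0
      ; 1#      = 1 , 0
      }

    homomorphism : Coefficients -Raw-AlmostCommutative⟶ fromCommutativeRing R
    homomorphism = record
      { ⟦_⟧    = ⟦_⟧ᵈ
      ; +-homo = λ { (a , b) (c , d) → begin
          ⟦ reduce (a +ℕ c , b +ℕ d) ⟧ᵈ                 ≈⟨ ⟦reduce⟧ (a +ℕ c) (b +ℕ d) ⟩
          ⟦ a +ℕ c , b +ℕ d ⟧ᵈ                          ≈⟨ ⟦⟧ᵈ-≈ (a +ℕ c) (b +ℕ d) ⟩
          (a +ℕ c) ×′ 1# - (b +ℕ d) ×′ 1#               ≈⟨ +-cong (×-homo-+ 1# a c) (-‿cong (×-homo-+ 1# b d)) ⟩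
          (a ×′ 1# + c ×′ 1#) - (b ×′ 1# + d ×′ 1#)     ≈⟨ -‿+-exchange _ _ _ _ ⟩
          (a ×′ 1# - b ×′ 1#) + (c ×′ 1# - d ×′ 1#)     ≈⟨ +-cong (⟦⟧ᵈ-≈ a b) (⟦⟧ᵈ-≈ c d) ⟨
          ⟦ a , b ⟧ᵈ + ⟦ c , d ⟧ᵈ                       ∎ }
      ; *-homo = λ { (a , b) (c , d) → begin
          ⟦ reduce (a *ℕ c +ℕ b *ℕ d , a *ℕ d +ℕ b *ℕ c) ⟧ᵈ
            ≈⟨ ⟦reduce⟧ (a *ℕ c +ℕ b *ℕ d) (a *ℕ d +ℕ b *ℕ c) ⟩
          ⟦ a *ℕ c +ℕ b *ℕ d , a *ℕ d +ℕ b *ℕ c ⟧ᵈ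
            ≈⟨ ⟦⟧ᵈ-≈ (a *ℕ c +ℕ b *ℕ d) (a *ℕ d +ℕ b *ℕ c) ⟩
          (a *ℕ c +ℕ b *ℕ d) ×′ 1# - (a *ℕ d +ℕ b *ℕ c) ×′ 1#
            ≈⟨ +-cong (trans (×-homo-+ 1# (a *ℕ c) (b *ℕ d)) (+-cong (×1-homo-* a c) (×1-homo-* b d)))
                      (-‿cong (trans (×-homo-+ 1# (a *ℕ d) (b *ℕ c)) (+-cong (×1-homo-* a d) (×1-homo-* b c)))) ⟩
          (a ×′ 1# * c ×′ 1# + b ×′ 1# * d ×′ 1#) - (a ×′ 1# * d ×′ 1# + b ×′ 1# * c ×′ 1#)
            ≈⟨ [a-b][c-d] _ _ _ _ ⟩
          (a ×′ 1# - b ×′ 1#) * (c ×′ 1# - d ×′ 1#)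
            ≈⟨ *-cong (⟦⟧ᵈ-≈ a b) (⟦⟧ᵈ-≈ c d) ⟨
          ⟦ a , b ⟧ᵈ * ⟦ c , d ⟧ᵈ
            ∎ }
      ; -‿homo = λ { (a , b) → begin
          ⟦ b , a ⟧ᵈ               ≈⟨ ⟦⟧ᵈ-≈ b a ⟩
          b ×′ 1# - a ×′ 1#        ≈⟨ ⁻¹-anti-homo‿- _ _ ⟨
          - (a ×′ 1# - b ×′ 1#)    ≈⟨ -‿cong (⟦⟧ᵈ-≈ a b) ⟨
          - ⟦ a , b ⟧ᵈ             ∎ }
      ; 0-homo = refl
      ; 1-homo = refl
      }

    equal? : ∀ x y → Maybe (⟦ x ⟧ᵈ ≈ ⟦ y ⟧ᵈ)
    equal? (a , b) (c , d) with a +ℕ d ℕ.≟ c +ℕ b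
    ... | yes a+d≡c+b = just (begin
      ⟦ a , b ⟧ᵈ          ≈⟨ ⟦⟧ᵈ-≈ a b ⟩
      a ×′ 1# - b ×′ 1#   ≈⟨ -‿cancel _ _ _ _ (trans (sym (×-homo-+ 1# a d)) (trans (×-congˡ a+d≡c+b) (×-homo-+ 1# c b))) ⟩
      c ×′ 1# - d ×′ 1#   ≈⟨ ⟦⟧ᵈ-≈ c d ⟨
      ⟦ c , d ⟧ᵈ          ∎)
    ... | no _ = nothing

  open import Algebra.Solver.Ring Coefficients (fromCommutativeRing R) homomorphism equal? public

injective⇒surjective : ∀ {N} {f : Fin N → Fin N} → Injective _≡_ _≡_ f → ∀ y → ∃ λ x → f x ≡ y
injective⇒surjective {zero}      _     ()
injective⇒surjective {suc N} {f} f-inj y with Fin.any? (λ x → f x Fin.≟ y)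
... | yes hit  = hit
... | no  miss = ⊥-elim (ℕ.1+n≰n (Fin.injective⇒≤ f′-injective))
  where
  y≢f : ∀ x → y ≢ f x
  y≢f x y≡fx = miss (x , ≡.sym y≡fx)

  f′ : Fin (suc N) → Fin N
  f′ x = Fin.punchOut (y≢f x)

  f′-injective : Injective _≡_ _≡_ f′
  f′-injective {x} {x′} eq = f-inj (Fin.punchOut-injective (y≢f x) (y≢f x′) eq)

module _ {a ℓ} {S : Setoid a ℓ} where
  open Setoid S

  finite-injective⇒surjective : ∀ {N} → Bijection (≡.setoid (Fin N)) S →
                                ∀ {f : Carrier → Carrier} → (∀ {x y} → x ≈ y → f x ≈ f y) →
                                Injective _≈_ _≈_ f → Surjective _≈_ _≈_ f
  finite-injective⇒surjective card {f} f-cong f-inj y =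
    to (proj₁ hit) , λ z≈x → trans (f-cong z≈x) f-hit
    where
    open Bijection card using (to; injective; surjective)
    from : Carrier → Fin _
    from x = proj₁ (surjective x)
    to-from : ∀ x → to (from x) ≈ x
    to-from x = proj₂ (surjective x) ≡.refl
    g : Fin _ → Fin _
    g i = from (f (to i))
    g-injective : Injective _≡_ _≡_ g
    g-injective {i} {j} eq = injective (f-inj (begin
      f (to i)             ≈⟨ to-from _ ⟨
      to (g i)             ≡⟨ ≡.cong to eq ⟩
      to (g j)             ≈⟨ to-from _ ⟩
      f (to j)             ∎))
      where open Relation.Binary.Reasoning.Setoid S
    hit : ∃ λ i → g i ≡ from y
    hit = injective⇒surjective g-injective (from y)
    f-hit : f (to (proj₁ hit)) ≈ y
    f-hit = trans (sym (to-from _)) (trans (reflexive (≡.cong to (proj₂ hit))) (to-from y))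

module Matrices {c ℓ} (R : RawRing c ℓ) where
  open RawRing R

  infixl 6 _-_
  _-_ : Carrier → Carrier → Carrier
  x - y = x + - y

  Vector3 : Set c
  Vector3 = Fin 3 → Carrier

  Matrix3 : Set c
  Matrix3 = Fin 3 → Fin 3 → Carrier

  infixl 7 _⋆_
  _⋆_ : Vector3 → Matrix3 → Vector3
  (v ⋆ M) j = v 0F * M 0F j + v 1F * M 1F j + v 2F * M 2F j

  identity : Matrix3
  identity 0F 0F = 1#
  identity 1F 1F = 1#
  identity 2F 2F = 1#
  identity 0F 1F = 0#
  identity 0F 2F = 0#
  identity 1F 0F = 0#
  identity 1F 2F = 0#
  identity 2F 0F = 0#
  identity 2F 1F = 0#

  det : Matrix3 → Carrier
  det N = N 0F 0F * (N 1F 1F * N 2F 2F - N 1F 2F * N 2F 1F)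
        - N 0F 1F * (N 1F 0F * N 2F 2F - N 1F 2F * N 2F 0F)
        + N 0F 2F * (N 1F 0F * N 2F 1F - N 1F 1F * N 2F 0F)

  adj : Matrix3 → Matrix3
  adj N 0F 0F =   N 1F 1F * N 2F 2F - N 1F 2F * N 2F 1F
  adj N 0F 1F = - (N 0F 1F * N 2F 2F - N 0F 2F * N 2F 1F)
  adj N 0F 2F =   N 0F 1F * N 1F 2F - N 0F 2F * N 1F 1F
  adj N 1F 0F = - (N 1F 0F * N 2F 2F - N 1F 2F * N 2F 0F)
  adj N 1F 1F =   N 0F 0F * N 2F 2F - N 0F 2F * N 2F 0F
  adj N 1F 2F = - (N 0F 0F * N 1F 2F - N 0F 2F * N 1F 0F)
  adj N 2F 0F =   N 1F 0F * N 2F 1F - N 1F 1F * N 2F 0F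
  adj N 2F 1F = - (N 0F 0F * N 2F 1F - N 0F 1F * N 2F 0F)
  adj N 2F 2F =   N 0F 0F * N 1F 1F - N 0F 1F * N 1F 0F

  -- (N₁ⱼ, -N₀ⱼ, 0): its product with N consists of 2×2 minors of the rows 0, 1.
  minorVector : Matrix3 → Fin 3 → Vector3
  minorVector N j 0F = N 1F j
  minorVector N j 1F = - N 0F j
  minorVector N j 2F = 0#

  -- The characteristic polynomial of Defs, transcribed over an arbitrary raw
  -- ring; over solver expressions it evaluates to Defs' one by computation.
  Polynomial : Set c
  Polynomial = List Carrier

  _⊞_ : Polynomial → Polynomial → Polynomial
  []      ⊞ g       = g
  (x ∷ f) ⊞ []      = x ∷ f
  (x ∷ f) ⊞ (y ∷ g) = (x + y) ∷ (f ⊞ g)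

  scale : Carrier → Polynomial → Polynomial
  scale a []      = []
  scale a (x ∷ f) = (a * x) ∷ scale a f

  _⊠_ : Polynomial → Polynomial → Polynomial
  []      ⊠ g = []
  (x ∷ f) ⊠ g = scale x g ⊞ (0# ∷ (f ⊠ g))

  ⊟_ : Polynomial → Polynomial
  ⊟ f = scale (- 1#) f

  coefficient : Polynomial → ℕ → Carrier
  coefficient []      _       = 0#
  coefficient (x ∷ f) zero    = x
  coefficient (x ∷ f) (suc k) = coefficient f k

  characteristic : Matrix3 → Polynomial
  characteristic M =
        (P 0F 0F ⊠ (P 1F 1F ⊠ P 2F 2F))
    ⊞ ((P 0F 1F ⊠ (P 1F 2F ⊠ P 2F 0F))
    ⊞ ((P 0F 2F ⊠ (P 1F 0F ⊠ P 2F 1F))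
    ⊞ ((⊟ (P 0F 2F ⊠ (P 1F 1F ⊠ P 2F 0F)))
    ⊞ ((⊟ (P 0F 1F ⊠ (P 1F 0F ⊠ P 2F 2F)))
    ⊞  (⊟ (P 0F 0F ⊠ (P 1F 2F ⊠ P 2F 1F)))))))
    where
    P : Fin 3 → Fin 3 → Polynomial
    P i j = (- M i j) ∷ (identity i j ∷ [])

  characteristicAtOne : Matrix3 → Carrier
  characteristicAtOne M = 1# - - coefficient χ 2 + coefficient χ 1 - - coefficient χ 0
    where χ = characteristic M

module FieldTheory (F : Field) where
  open Field F hiding (zero)
  open import Algebra.Properties.Ring ring using (-0#≈0#; -‿distribˡ-*; x+x≈x⇒x≈0; [y-z]x≈yx-zx; +-cancelˡ; +-cancelʳ)
  open import Algebra.Properties.Group +-group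
    using (x∙y⁻¹≈ε⇒x≈y; x≈y⇒x∙y⁻¹≈ε; inverseˡ-unique; inverseʳ-unique; ⁻¹-injective)
  open import Algebra.Morphism.Structures using (module RingMorphisms)
  open RingMorphisms rawRing rawRing public using (IsRingHomomorphism)
  import Algebra.Morphism.Construct.Identity as Identity
  import Algebra.Morphism.Construct.Composition as Composition
  open import Relation.Binary.Reasoning.Setoid setoid
  open import Algebra.Properties.Semiring.Sum semiring
    using (sum; sum-syntax; sum-cong-≋; sum-cong-≗; ∑-distrib-+; *-distribˡ-sum; *-distribʳ-sum; sum-replicate-zero; sum-init-last)
  open IntegerCoefficientSolver commRing
    using (Polynomial; con; var; _:+_; _:*_; :-_; _:=_; solve; prove)
  open Matrices rawRing public using (Vector3; _⋆_; det; adj; minorVector)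
  open import Data.Vec.Functional public using (map)
  open import Data.Vec.Functional.Relation.Binary.Equality.Setoid setoid public using (_≋_)

  x*y≈0⇒x≈0 : ∀ {x y} → ¬ (y ≈ 0#) → x * y ≈ 0# → x ≈ 0#
  x*y≈0⇒x≈0 {x} {y} y≉0 xy≈0 = begin
    x                   ≈⟨ *-identityʳ x ⟨
    x * 1#              ≈⟨ *-congˡ (inverseʳ y y≉0) ⟨
    x * (y * y ⁻¹)      ≈⟨ *-assoc x y (y ⁻¹) ⟨
    (x * y) * y ⁻¹      ≈⟨ *-congʳ xy≈0 ⟩
    0# * y ⁻¹           ≈⟨ zeroˡ (y ⁻¹) ⟩
    0#                  ∎

  -x≈0⇒x≈0 : ∀ {x} → - x ≈ 0# → x ≈ 0#
  -x≈0⇒x≈0 -x≈0 = ⁻¹-injective (trans -x≈0 (sym -0#≈0#))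

  *-cancelˡ-nonZero : ∀ {d x y} → ¬ (d ≈ 0#) → d * x ≈ d * y → x ≈ y
  *-cancelˡ-nonZero {d} {x} {y} d≉0 dx≈dy = x∙y⁻¹≈ε⇒x≈y x y (x*y≈0⇒x≈0 d≉0 (begin
    (x - y) * d     ≈⟨ [y-z]x≈yx-zx d x y ⟩
    x * d - y * d   ≈⟨ x≈y⇒x∙y⁻¹≈ε (trans (*-comm x d) (trans dx≈dy (*-comm d y))) ⟩
    0#              ∎))

  automorphism⇒isRingHomomorphism : ∀ {σ} → IsAutomorphism F σ → IsRingHomomorphism σ
  automorphism⇒isRingHomomorphism {σ} auto = record
    { isSemiringHomomorphism = record
      { isNearSemiringHomomorphism = record
        { +-isMonoidHomomorphism = record
          { isMagmaHomomorphism = record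
            { isRelHomomorphism = record { cong = σ-cong }
            ; homo = σ-+ }
          ; ε-homo = σ-0 }
        ; *-homo = σ-* }
      ; 1#-homo = σ-1 }
    ; -‿homo = λ x → inverseˡ-unique (σ (- x)) (σ x) (begin
        σ (- x) + σ x   ≈⟨ σ-+ (- x) x ⟨
        σ (- x + x)     ≈⟨ σ-cong (-‿inverseˡ x) ⟩
        σ 0#            ≈⟨ σ-0 ⟩
        0#              ∎) }
    where
    open IsAutomorphism auto
    σ-0 : σ 0# ≈ 0#
    σ-0 = x+x≈x⇒x≈0 (σ 0#) (trans (sym (σ-+ 0# 0#)) (σ-cong (+-identityʳ 0#)))

  iter-isRingHomomorphism : ∀ {σ} → IsRingHomomorphism σ → ∀ k → IsRingHomomorphism (iter F σ k)
  iter-isRingHomomorphism σ-hom zero    = Identity.isRingHomomorphism rawRing refl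
  iter-isRingHomomorphism σ-hom (suc k) =
    Composition.isRingHomomorphism trans (iter-isRingHomomorphism σ-hom k) σ-hom

  iter-suc : ∀ f k x → iter F f (suc k) x ≡ iter F f k (f x)
  iter-suc f zero    x = ≡.refl
  iter-suc f (suc k) x = ≡.cong f (iter-suc f k x)

  iter-+ : ∀ f i k x → iter F f (i ℕ.+ k) x ≡ iter F f i (iter F f k x)
  iter-+ f zero    k x = ≡.refl
  iter-+ f (suc i) k x = ≡.cong f (iter-+ f i k x)

  iter-cong : ∀ {f} → (∀ {x y} → x ≈ y → f x ≈ f y) → ∀ k {x y} → x ≈ y → iter F f k x ≈ iter F f k y
  iter-cong f-cong zero    x≈y = x≈y
  iter-cong f-cong (suc k) x≈y = f-cong (iter-cong f-cong k x≈y)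

  iter-injective : ∀ {f} → Injective _≈_ _≈_ f → ∀ k → Injective _≈_ _≈_ (iter F f k)
  iter-injective f-inj zero    eq = eq
  iter-injective f-inj (suc k) eq = iter-injective f-inj k (f-inj eq)

  iter-leftInverse : ∀ {f g} → (∀ {x y} → x ≈ y → g x ≈ g y) → (∀ x → g (f x) ≈ x) →
                     ∀ k x → iter F g k (iter F f k x) ≈ x
  iter-leftInverse g-cong gf zero    x = refl
  iter-leftInverse {f} {g} g-cong gf (suc k) x = begin
    iter F g (suc k) (f (iter F f k x))   ≡⟨ iter-suc g k _ ⟩
    iter F g k (g (f (iter F f k x)))     ≈⟨ iter-cong g-cong k (gf _) ⟩
    iter F g k (iter F f k x)             ≈⟨ iter-leftInverse g-cong gf k x ⟩
    x                                     ∎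

  hasOrder-leftInverse : ∀ {f g n} → (∀ {x y} → x ≈ y → g x ≈ g y) → (∀ x → g (f x) ≈ x) →
                         HasOrder F f n → HasOrder F g n
  hasOrder-leftInverse {f} {g} {n} g-cong gf (fⁿ≈id , f-order) = gⁿ≈id , g-order
    where
    gⁿ≈id : ∀ y → iter F g n y ≈ y
    gⁿ≈id y = trans (iter-cong g-cong n (sym (fⁿ≈id y))) (iter-leftInverse g-cong gf n y)
    g-order : ∀ k → 0 ℕ.< k → k ℕ.< n → ∃ λ y → ¬ (iter F g k y ≈ y)
    g-order k 0<k k<n with f-order k 0<k k<n
    ... | x , fᵏx≉x = iter F f k x , λ eq → fᵏx≉x (sym (trans (sym (iter-leftInverse g-cong gf k x)) eq))

  hasOrder⇒iterates-separated : ∀ {f n} → Injective _≈_ _≈_ f → HasOrder F f n →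
                                ∀ {i j} → i ℕ.< j → j ℕ.< n → ∃ λ μ → ¬ (iter F f i μ ≈ iter F f j μ)
  hasOrder⇒iterates-separated {f} f-inj (_ , f-order) {i} i<j j<n with ℕ.m≤n⇒∃[o]m+o≡n i<j
  ... | k , ≡.refl with f-order (suc k) (s≤s z≤n) (ℕ.≤-<-trans (s≤s (ℕ.m≤n+m k i)) j<n)
  ...   | μ , fᵏ⁺¹μ≉μ = μ , λ eq → fᵏ⁺¹μ≉μ (sym (iter-injective f-inj i (trans eq (reflexive fʲ≡fⁱfᵏ⁺¹))))
    where
    fʲ≡fⁱfᵏ⁺¹ : iter F f (suc (i ℕ.+ k)) μ ≡ iter F f i (iter F f (suc k) μ)
    fʲ≡fⁱfᵏ⁺¹ = ≡.trans (≡.cong (λ m → iter F f m μ) (≡.sym (ℕ.+-suc i k))) (iter-+ f i (suc k) μ)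

  hasOrder⇒iterates-distinct : ∀ {f n} → Injective _≈_ _≈_ f → HasOrder F f n →
                               ∀ (i j : Fin n) → i ≢ j → ∃ λ μ → ¬ (iter F f (toℕ i) μ ≈ iter F f (toℕ j) μ)
  hasOrder⇒iterates-distinct f-inj order i j i≢j with ℕ.<-cmp (toℕ i) (toℕ j)
  ... | tri< i<j _ _ = hasOrder⇒iterates-separated f-inj order i<j (Fin.toℕ<n j)
  ... | tri≈ _ i≡j _ = ⊥-elim (i≢j (Fin.toℕ-injective i≡j))
  ... | tri> _ _ j<i with μ , ne ← hasOrder⇒iterates-separated f-inj order j<i (Fin.toℕ<n i)
    = μ , λ eq → ne (sym eq)

  sum-linear : ∀ {k} (f g : Fin k → Carrier) y → ∑[ i < k ] (f i - y * g i) ≈ ∑[ i < k ] f i - y * ∑[ i < k ] g i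
  sum-linear f g y = begin
    ∑[ i < _ ] (f i - y * g i)          ≈⟨ ∑-distrib-+ f (λ i → - (y * g i)) ⟩
    sum f + ∑[ i < _ ] (- (y * g i))    ≈⟨ +-congˡ (sum-cong-≋ (λ i → -‿distribˡ-* y (g i))) ⟩
    sum f + ∑[ i < _ ] (- y * g i)      ≈⟨ +-congˡ (*-distribˡ-sum (- y) g) ⟨
    sum f + - y * sum g                 ≈⟨ +-congˡ (-‿distribˡ-* y (sum g)) ⟨
    sum f - y * sum g                   ∎

  sum-rotate : ∀ n (f : ℕ → Carrier) → f n ≈ f 0 → ∑[ i < n ] f (suc (toℕ i)) ≈ ∑[ i < n ] f (toℕ i)
  sum-rotate n f fn≈f0 = +-cancelʳ (f 0) _ _ (begin
    ∑[ i < n ] f (suc (toℕ i)) + f 0          ≈⟨ +-comm _ _ ⟩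
    ∑[ i < suc n ] f (toℕ i)                  ≈⟨ sum-init-last (λ i → f (toℕ i)) ⟩
    ∑[ i < n ] f (toℕ (Fin.inject₁ i)) + f (toℕ (Fin.fromℕ n))
      ≡⟨ ≡.cong₂ _+_ (sum-cong-≗ {n} (λ i → ≡.cong f (Fin.toℕ-inject₁ i))) (≡.cong f (Fin.toℕ-fromℕ n)) ⟩
    ∑[ i < n ] f (toℕ i) + f n                ≈⟨ +-congˡ fn≈f0 ⟩
    ∑[ i < n ] f (toℕ i) + f 0                ∎)

  homo-sum : ∀ {f} → IsRingHomomorphism f → ∀ {k} (v : Fin k → Carrier) → f (sum v) ≈ sum (map f v)
  homo-sum f-hom {zero}  v = IsRingHomomorphism.0#-homo f-hom
  homo-sum f-hom {suc k} v =
    trans (IsRingHomomorphism.+-homo f-hom _ _) (+-congˡ (homo-sum f-hom (λ i → v (Fin.suc i))))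

  characters-independent : ∀ {k} (χ : Fin k → Carrier → Carrier) →
    (∀ i x y → χ i (x * y) ≈ χ i x * χ i y) → (∀ i → χ i 1# ≈ 1#) →
    (∀ i j → i ≢ j → ∃ λ μ → ¬ (χ i μ ≈ χ j μ)) →
    (c : Fin k → Carrier) → (∀ x → ∑[ i < k ] (χ i x * c i) ≈ 0#) → ∀ i → c i ≈ 0#
  characters-independent {zero}  χ χ-* χ-1 distinct c vanish ()
  characters-independent {suc k} χ χ-* χ-1 distinct c vanish = c≈0
    where
    χ′ : Fin k → Carrier → Carrier
    χ′ i = χ (Fin.suc i)

    rest : Carrier → Carrier
    rest x = ∑[ i < k ] (χ′ i x * c (Fin.suc i))

    rest≈ : ∀ x → rest x ≈ - (χ 0F x * c 0F)
    rest≈ x = inverseʳ-unique _ _ (vanish x)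

    -- Σᵢ χᵢ(μx) cᵢ - χ₀(μ) Σᵢ χᵢ(x) cᵢ eliminates the term i = 0.
    c′ : Carrier → Fin k → Carrier
    c′ μ i = c (Fin.suc i) * (χ′ i μ - χ 0F μ)

    c′-vanish : ∀ μ x → ∑[ i < k ] (χ′ i x * c′ μ i) ≈ 0#
    c′-vanish μ x = begin
      ∑[ i < k ] (χ′ i x * c′ μ i)
        ≈⟨ sum-cong-≋ (λ i → trans (regroup _ _ _ _) (+-congʳ (*-congʳ (sym (χ-* (Fin.suc i) μ x))))) ⟩
      ∑[ i < k ] (χ′ i (μ * x) * c (Fin.suc i) - χ 0F μ * (χ′ i x * c (Fin.suc i)))
        ≈⟨ sum-linear (λ i → χ′ i (μ * x) * c (Fin.suc i)) (λ i → χ′ i x * c (Fin.suc i)) (χ 0F μ) ⟩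
      rest (μ * x) - χ 0F μ * rest x
        ≈⟨ +-cong (trans (rest≈ (μ * x)) (-‿cong (*-congʳ (χ-* 0F μ x)))) (-‿cong (*-congˡ (rest≈ x))) ⟩
      - (χ 0F μ * χ 0F x * c 0F) - χ 0F μ * - (χ 0F x * c 0F)
        ≈⟨ cancel _ _ _ ⟩
      0# ∎
      where
      regroup : ∀ x′ c₁ m m₀ → x′ * (c₁ * (m - m₀)) ≈ m * x′ * c₁ - m₀ * (x′ * c₁)
      regroup = solve 4 (λ x′ c₁ m m₀ → x′ :* (c₁ :* (m :+ :- m₀)) := m :* x′ :* c₁ :+ :- (m₀ :* (x′ :* c₁))) refl
      cancel : ∀ m₀ x₀ c₀ → - (m₀ * x₀ * c₀) - m₀ * - (x₀ * c₀) ≈ 0#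
      cancel = solve 3 (λ m₀ x₀ c₀ → :- (m₀ :* x₀ :* c₀) :+ :- (m₀ :* :- (x₀ :* c₀)) := con (0 , 0)) refl

    c′≈0 : ∀ μ i → c′ μ i ≈ 0#
    c′≈0 μ = characters-independent χ′ (λ i → χ-* (Fin.suc i)) (λ i → χ-1 (Fin.suc i))
               (λ i j i≢j → distinct (Fin.suc i) (Fin.suc j) (λ eq → i≢j (Fin.suc-injective eq)))
               (c′ μ) (c′-vanish μ)

    c-suc≈0 : ∀ i → c (Fin.suc i) ≈ 0#
    c-suc≈0 i with μ , χᵢμ≉χ₀μ ← distinct (Fin.suc i) 0F (λ ())
      = x*y≈0⇒x≈0 (λ eq → χᵢμ≉χ₀μ (x∙y⁻¹≈ε⇒x≈y _ _ eq)) (c′≈0 μ i)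

    c≈0 : ∀ i → c i ≈ 0#
    c≈0 0F = begin
      c 0F                     ≈⟨ *-identityˡ _ ⟨
      1# * c 0F                ≈⟨ *-congʳ (χ-1 0F) ⟨
      χ 0F 1# * c 0F           ≈⟨ +-identityʳ _ ⟨
      χ 0F 1# * c 0F + 0#      ≈⟨ +-congˡ (sum-replicate-zero k) ⟨
      χ 0F 1# * c 0F + ∑[ i < k ] 0#
        ≈⟨ +-congˡ (sum-cong-≋ (λ i → trans (*-congˡ (c-suc≈0 i)) (zeroʳ _))) ⟨
      χ 0F 1# * c 0F + rest 1# ≈⟨ vanish 1# ⟩
      0#                       ∎
    c≈0 (Fin.suc i) = c-suc≈0 i

  0ᵥ : Vector3
  0ᵥ _ = 0#

  _≋ₘ_ : Mat3 F → Mat3 F → Set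
  M ≋ₘ N = ∀ i → M i ≋ N i

  ⋆-cong : ∀ {u v M N} → u ≋ v → M ≋ₘ N → u ⋆ M ≋ v ⋆ N
  ⋆-cong u≋v M≋N j = +-cong (+-cong (*-cong (u≋v 0F) (M≋N 0F j)) (*-cong (u≋v 1F) (M≋N 1F j)))
                            (*-cong (u≋v 2F) (M≋N 2F j))

  ⊗-cong : ∀ {M M′ N N′} → M ≋ₘ M′ → N ≋ₘ N′ → _⊗_ F M N ≋ₘ _⊗_ F M′ N′
  ⊗-cong M≋M′ N≋N′ i = ⋆-cong (M≋M′ i) N≋N′

  ⋆-⊗ : ∀ v M N → v ⋆ _⊗_ F M N ≋ (v ⋆ M) ⋆ N
  ⋆-⊗ v M N j = solve 15
    (λ v₀ v₁ v₂ m₀₀ m₀₁ m₀₂ m₁₀ m₁₁ m₁₂ m₂₀ m₂₁ m₂₂ n₀ n₁ n₂ →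
         v₀ :* (m₀₀ :* n₀ :+ m₀₁ :* n₁ :+ m₀₂ :* n₂)
      :+ v₁ :* (m₁₀ :* n₀ :+ m₁₁ :* n₁ :+ m₁₂ :* n₂)
      :+ v₂ :* (m₂₀ :* n₀ :+ m₂₁ :* n₁ :+ m₂₂ :* n₂)
      :=    (v₀ :* m₀₀ :+ v₁ :* m₁₀ :+ v₂ :* m₂₀) :* n₀
         :+ (v₀ :* m₀₁ :+ v₁ :* m₁₁ :+ v₂ :* m₂₁) :* n₁
         :+ (v₀ :* m₀₂ :+ v₁ :* m₁₂ :+ v₂ :* m₂₂) :* n₂)
    refl (v 0F) (v 1F) (v 2F) (M 0F 0F) (M 0F 1F) (M 0F 2F) (M 1F 0F) (M 1F 1F) (M 1F 2F)
         (M 2F 0F) (M 2F 1F) (M 2F 2F) (N 0F j) (N 1F j) (N 2F j)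

  private
    1x+0y+0z≈x : ∀ x y z → 1# * x + 0# * y + 0# * z ≈ x
    1x+0y+0z≈x = solve 3 (λ x y z → con (1 , 0) :* x :+ con (0 , 0) :* y :+ con (0 , 0) :* z := x) refl

    0x+1y+0z≈y : ∀ x y z → 0# * x + 1# * y + 0# * z ≈ y
    0x+1y+0z≈y = solve 3 (λ x y z → con (0 , 0) :* x :+ con (1 , 0) :* y :+ con (0 , 0) :* z := y) refl

    0x+0y+1z≈z : ∀ x y z → 0# * x + 0# * y + 1# * z ≈ z
    0x+0y+1z≈z = solve 3 (λ x y z → con (0 , 0) :* x :+ con (0 , 0) :* y :+ con (1 , 0) :* z := z) refl

  ⋆-identityʳ : ∀ v → v ⋆ I3 F ≋ v
  ⋆-identityʳ v 0F = trans (+-cong (+-cong (*-comm _ _) (*-comm _ _)) (*-comm _ _)) (1x+0y+0z≈x _ _ _)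
  ⋆-identityʳ v 1F = trans (+-cong (+-cong (*-comm _ _) (*-comm _ _)) (*-comm _ _)) (0x+1y+0z≈y _ _ _)
  ⋆-identityʳ v 2F = trans (+-cong (+-cong (*-comm _ _) (*-comm _ _)) (*-comm _ _)) (0x+0y+1z≈z _ _ _)

  identity-⋆ : ∀ i M → I3 F i ⋆ M ≋ M i
  identity-⋆ 0F M j = 1x+0y+0z≈x _ _ _
  identity-⋆ 1F M j = 0x+1y+0z≈y _ _ _
  identity-⋆ 2F M j = 0x+0y+1z≈z _ _ _

  module _ {f} (f-hom : IsRingHomomorphism f) where
    open IsRingHomomorphism f-hom using (⟦⟧-cong; +-homo; *-homo; 0#-homo; 1#-homo)

    homo-⋆ : ∀ v M → map f (v ⋆ M) ≋ map f v ⋆ mapMat F f M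
    homo-⋆ v M j = trans (+-homo _ _) (+-cong (trans (+-homo _ _) (+-cong (*-homo _ _) (*-homo _ _))) (*-homo _ _))

    mapMat-⊗ : ∀ M N → mapMat F f (_⊗_ F M N) ≋ₘ _⊗_ F (mapMat F f M) (mapMat F f N)
    mapMat-⊗ M N i = homo-⋆ (M i) N

    mapMat-identity : mapMat F f (I3 F) ≋ₘ I3 F
    mapMat-identity 0F 0F = 1#-homo
    mapMat-identity 0F 1F = 0#-homo
    mapMat-identity 0F 2F = 0#-homo
    mapMat-identity 1F 0F = 0#-homo
    mapMat-identity 1F 1F = 1#-homo
    mapMat-identity 1F 2F = 0#-homo
    mapMat-identity 2F 0F = 0#-homo
    mapMat-identity 2F 1F = 0#-homo
    mapMat-identity 2F 2F = 1#-homo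

    prodFrom-suc : ∀ M i k → prodFrom F f M (suc i) k ≋ₘ mapMat F f (prodFrom F f M i k)
    prodFrom-suc M i zero    a b = sym (mapMat-identity a b)
    prodFrom-suc M i (suc k) a b = begin
      _⊗_ F (mapMat F (iter F f (suc i)) M) (prodFrom F f M (suc (suc i)) k) a b
        ≈⟨ ⊗-cong {M = mapMat F (iter F f (suc i)) M} (λ _ _ → refl) (prodFrom-suc M (suc i) k) a b ⟩
      _⊗_ F (mapMat F f (mapMat F (iter F f i) M)) (mapMat F f (prodFrom F f M (suc i) k)) a b
        ≈⟨ mapMat-⊗ (mapMat F (iter F f i) M) (prodFrom F f M (suc i) k) a b ⟨
      mapMat F f (prodFrom F f M i (suc k)) a b
        ∎

  ⋆-sum : ∀ {k} (vs : Fin k → Vector3) M → (λ j → ∑[ i < k ] vs i j) ⋆ M ≋ (λ j → ∑[ i < k ] (vs i ⋆ M) j)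
  ⋆-sum vs M j = begin
    sum (λ i → vs i 0F) * M 0F j + sum (λ i → vs i 1F) * M 1F j + sum (λ i → vs i 2F) * M 2F j
      ≈⟨ +-cong (+-cong (*-distribʳ-sum (M 0F j) (λ i → vs i 0F)) (*-distribʳ-sum (M 1F j) (λ i → vs i 1F)))
                (*-distribʳ-sum (M 2F j) (λ i → vs i 2F)) ⟩
    sum (λ i → vs i 0F * M 0F j) + sum (λ i → vs i 1F * M 1F j) + sum (λ i → vs i 2F * M 2F j)
      ≈⟨ +-congʳ (∑-distrib-+ (λ i → vs i 0F * M 0F j) (λ i → vs i 1F * M 1F j)) ⟨
    sum (λ i → vs i 0F * M 0F j + vs i 1F * M 1F j) + sum (λ i → vs i 2F * M 2F j)
      ≈⟨ ∑-distrib-+ (λ i → vs i 0F * M 0F j + vs i 1F * M 1F j) (λ i → vs i 2F * M 2F j) ⟨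
    sum (λ i → (vs i ⋆ M) j)
      ∎

  ⋆-scale : ∀ x v M → map (x *_) v ⋆ M ≋ map (x *_) (v ⋆ M)
  ⋆-scale x v M j = solve 7
    (λ x v₀ v₁ v₂ m₀ m₁ m₂ → x :* v₀ :* m₀ :+ x :* v₁ :* m₁ :+ x :* v₂ :* m₂ := x :* (v₀ :* m₀ :+ v₁ :* m₁ :+ v₂ :* m₂))
    refl x (v 0F) (v 1F) (v 2F) (M 0F j) (M 1F j) (M 2F j)

  twisted-⋆prodFrom : ∀ {σ} → IsRingHomomorphism σ → ∀ M w → w ⋆ M ≋ map σ w →
                      ∀ k → w ⋆ prodFrom F σ M 0 k ≋ map (iter F σ k) w
  twisted-⋆prodFrom σ-hom M w twisted zero    = ⋆-identityʳ w
  twisted-⋆prodFrom {σ} σ-hom M w twisted (suc k) j = begin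
    (w ⋆ _⊗_ F M (prodFrom F σ M 1 k)) j           ≈⟨ ⋆-⊗ w M (prodFrom F σ M 1 k) j ⟩
    (w ⋆ M ⋆ prodFrom F σ M 1 k) j                 ≈⟨ ⋆-cong twisted (prodFrom-suc σ-hom M 0 k) j ⟩
    (map σ w ⋆ mapMat F σ (prodFrom F σ M 0 k)) j  ≈⟨ homo-⋆ σ-hom w (prodFrom F σ M 0 k) j ⟨
    σ ((w ⋆ prodFrom F σ M 0 k) j)                 ≈⟨ ⟦⟧-cong (twisted-⋆prodFrom σ-hom M w twisted k j) ⟩
    σ (iter F σ k (w j))                           ∎
    where open IsRingHomomorphism σ-hom using (⟦⟧-cong)

  expressions : ℕ → RawRing _ _
  expressions m = record
    { Carrier = Polynomial m ; _≈_ = _≡_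
    ; _+_ = _:+_ ; _*_ = _:*_ ; -_ = :-_ ; 0# = con (0 , 0) ; 1# = con (1 , 0) }

  module E = Matrices (expressions 9)
  module E⁺ = Matrices (expressions 12)

  entries : Mat3 F → Vec Carrier 9
  entries N = N 0F 0F ∷ N 0F 1F ∷ N 0F 2F ∷ N 1F 0F ∷ N 1F 1F ∷ N 1F 2F ∷ N 2F 0F ∷ N 2F 1F ∷ N 2F 2F ∷ []

  entries⁺ : Mat3 F → Vector3 → Vec Carrier 12
  entries⁺ N v = entries N Vec.++ (v 0F ∷ v 1F ∷ v 2F ∷ [])

  X : E.Matrix3
  X i j = var (Fin.combine i j)

  X⁺ : E⁺.Matrix3
  X⁺ i j = var (Fin.combine i j Fin.↑ˡ 3)

  x⁺ : E⁺.Vector3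
  x⁺ k = var (9 Fin.↑ʳ k)

  characteristicAtOne≈det[I-M] : ∀ M →
    1# - χ₂ F M + χ₁ F M - χ₀ F M ≈ det (λ i j → I3 F i j - M i j)
  characteristicAtOne≈det[I-M] M = prove (entries M)
    (E.characteristicAtOne X) (E.det (λ i j → E.identity i j E.- X i j)) refl

  ⋆-adj : ∀ N v → (v ⋆ N) ⋆ adj N ≋ map (det N *_) v
  ⋆-adj N v 0F = prove (entries⁺ N v) ((x⁺ E⁺.⋆ X⁺ E⁺.⋆ E⁺.adj X⁺) 0F) (E⁺.det X⁺ :* x⁺ 0F) refl
  ⋆-adj N v 1F = prove (entries⁺ N v) ((x⁺ E⁺.⋆ X⁺ E⁺.⋆ E⁺.adj X⁺) 1F) (E⁺.det X⁺ :* x⁺ 1F) refl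
  ⋆-adj N v 2F = prove (entries⁺ N v) ((x⁺ E⁺.⋆ X⁺ E⁺.⋆ E⁺.adj X⁺) 2F) (E⁺.det X⁺ :* x⁺ 2F) refl

  adj-⋆ : ∀ N v → (v ⋆ adj N) ⋆ N ≋ map (det N *_) v
  adj-⋆ N v 0F = prove (entries⁺ N v) ((x⁺ E⁺.⋆ E⁺.adj X⁺ E⁺.⋆ X⁺) 0F) (E⁺.det X⁺ :* x⁺ 0F) refl
  adj-⋆ N v 1F = prove (entries⁺ N v) ((x⁺ E⁺.⋆ E⁺.adj X⁺ E⁺.⋆ X⁺) 1F) (E⁺.det X⁺ :* x⁺ 1F) refl
  adj-⋆ N v 2F = prove (entries⁺ N v) ((x⁺ E⁺.⋆ E⁺.adj X⁺ E⁺.⋆ X⁺) 2F) (E⁺.det X⁺ :* x⁺ 2F) refl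

  minorVector-⋆ : ∀ N → (∀ i k → adj N i k ≈ 0#) → ∀ j → minorVector N j ⋆ N ≋ 0ᵥ
  minorVector-⋆ N adj≈0 = minor≈0
    where
    minor : Fin 3 → Fin 3 → Polynomial 9
    minor j l = (E.minorVector X j E.⋆ X) l

    ≈adj : ∀ {x} i k → x ≈ adj N i k → x ≈ 0#
    ≈adj i k x≈adj = trans x≈adj (adj≈0 i k)

    ≈-adj : ∀ {x} i k → x ≈ - adj N i k → x ≈ 0#
    ≈-adj i k x≈-adj = trans x≈-adj (trans (-‿cong (adj≈0 i k)) -0#≈0#)

    minor≈0 : ∀ j l → (minorVector N j ⋆ N) l ≈ 0#
    minor≈0 0F 0F = prove (entries N) (minor 0F 0F) (con (0 , 0)) refl
    minor≈0 0F 1F = ≈-adj 2F 2F (prove (entries N) (minor 0F 1F) (:- E.adj X 2F 2F) refl)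
    minor≈0 0F 2F = ≈adj  1F 2F (prove (entries N) (minor 0F 2F) (E.adj X 1F 2F) refl)
    minor≈0 1F 0F = ≈adj  2F 2F (prove (entries N) (minor 1F 0F) (E.adj X 2F 2F) refl)
    minor≈0 1F 1F = prove (entries N) (minor 1F 1F) (con (0 , 0)) refl
    minor≈0 1F 2F = ≈-adj 0F 2F (prove (entries N) (minor 1F 2F) (:- E.adj X 0F 2F) refl)
    minor≈0 2F 0F = ≈-adj 1F 2F (prove (entries N) (minor 2F 0F) (:- E.adj X 1F 2F) refl)
    minor≈0 2F 1F = ≈adj  0F 2F (prove (entries N) (minor 2F 1F) (E.adj X 0F 2F) refl)
    minor≈0 2F 2F = prove (entries N) (minor 2F 2F) (con (0 , 0)) refl

  0ᵥ-⋆ : ∀ M → 0ᵥ ⋆ M ≋ 0ᵥ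
  0ᵥ-⋆ M j = solve 3 (λ x y z → con (0 , 0) :* x :+ con (0 , 0) :* y :+ con (0 , 0) :* z := con (0 , 0)) refl _ _ _

  ⋆[I-M] : ∀ u M → u ⋆ (λ i j → I3 F i j - M i j) ≋ (λ j → u j - (u ⋆ M) j)
  ⋆[I-M] u M 0F = prove (entries⁺ M u) ((x⁺ E⁺.⋆ (λ i j → E⁺.identity i j E⁺.- X⁺ i j)) 0F) (x⁺ 0F E⁺.- (x⁺ E⁺.⋆ X⁺) 0F) refl
  ⋆[I-M] u M 1F = prove (entries⁺ M u) ((x⁺ E⁺.⋆ (λ i j → E⁺.identity i j E⁺.- X⁺ i j)) 1F) (x⁺ 1F E⁺.- (x⁺ E⁺.⋆ X⁺) 1F) refl
  ⋆[I-M] u M 2F = prove (entries⁺ M u) ((x⁺ E⁺.⋆ (λ i j → E⁺.identity i j E⁺.- X⁺ i j)) 2F) (x⁺ 2F E⁺.- (x⁺ E⁺.⋆ X⁺) 2F) refl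

  ⋆[I-M]≈0⇒fixed : ∀ u M → u ⋆ (λ i j → I3 F i j - M i j) ≋ 0ᵥ → u ⋆ M ≋ u
  ⋆[I-M]≈0⇒fixed u M u⋆[I-M]≈0 j = sym (x∙y⁻¹≈ε⇒x≈y _ _ (trans (sym (⋆[I-M] u M j)) (u⋆[I-M]≈0 j)))

  fixed⇒⋆[I-M]≈0 : ∀ u M → u ⋆ M ≋ u → u ⋆ (λ i j → I3 F i j - M i j) ≋ 0ᵥ
  fixed⇒⋆[I-M]≈0 u M u-fixed j = trans (⋆[I-M] u M j) (x≈y⇒x∙y⁻¹≈ε (sym (u-fixed j)))

  det≉0⇒leftKernel-trivial : ∀ N → ¬ (det N ≈ 0#) → ∀ u → u ⋆ N ≋ 0ᵥ → u ≋ 0ᵥ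
  det≉0⇒leftKernel-trivial N det≉0 u u⋆N≈0 j = x*y≈0⇒x≈0 det≉0 (begin
    u j * det N              ≈⟨ *-comm _ _ ⟩
    det N * u j              ≈⟨ ⋆-adj N u j ⟨
    (u ⋆ N ⋆ adj N) j        ≈⟨ ⋆-cong {M = adj N} u⋆N≈0 (λ _ _ → refl) j ⟩
    (0ᵥ ⋆ adj N) j           ≈⟨ 0ᵥ-⋆ (adj N) j ⟩
    0#                       ∎)

  -- adj N · N = det N · I puts the rows of adj N into the left kernel, so adj N = 0;
  -- then the 2×2 minors vanish and the vectors (N₁ⱼ, -N₀ⱼ, 0) kill row 0 of N,
  -- which puts (1, 0, 0) into the left kernel.
  leftKernel-trivial⇒det≉0 : ∀ N → (∀ u → u ⋆ N ≋ 0ᵥ → u ≋ 0ᵥ) → ¬ (det N ≈ 0#)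
  leftKernel-trivial⇒det≉0 N kernel-trivial det≈0 = 0≉1 (sym (kernel-trivial (I3 F 0F) e₀⋆N≈0 0F))
    where
    adj≈0 : ∀ i k → adj N i k ≈ 0#
    adj≈0 i k = begin
      adj N i k              ≈⟨ identity-⋆ i (adj N) k ⟨
      (I3 F i ⋆ adj N) k      ≈⟨ kernel-trivial (I3 F i ⋆ adj N) (λ j → trans (adj-⋆ N (I3 F i) j) (trans (*-congʳ det≈0) (zeroˡ _))) k ⟩
      0#                     ∎
    row₀≈0 : ∀ j → N 0F j ≈ 0#
    row₀≈0 j = -x≈0⇒x≈0 (kernel-trivial (minorVector N j) (minorVector-⋆ N adj≈0 j) 1F)
    e₀⋆N≈0 : I3 F 0F ⋆ N ≋ 0ᵥ
    e₀⋆N≈0 j = trans (identity-⋆ 0F N j) (row₀≈0 j)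

  module Descent {σ} (σ-hom : IsRingHomomorphism σ) {m} (order : HasOrder F σ (suc m)) (M : Mat3 F) where
    private
      n : ℕ
      n = suc m

      -- σⁿ = id makes τ = σⁿ⁻¹ the inverse of σ.
      τ : Carrier → Carrier
      τ = iter F σ m

      τ-hom : IsRingHomomorphism τ
      τ-hom = iter-isRingHomomorphism σ-hom m

      module σ = IsRingHomomorphism σ-hom
      module τ = IsRingHomomorphism τ-hom

      στ≈id : ∀ x → σ (τ x) ≈ x
      στ≈id = proj₁ order

      τσ≈id : ∀ x → τ (σ x) ≈ x
      τσ≈id x = trans (reflexive (≡.sym (iter-suc σ m x))) (proj₁ order x)

      τ-injective : Injective _≈_ _≈_ τ
      τ-injective {x} {y} τx≈τy = trans (sym (στ≈id x)) (trans (σ.⟦⟧-cong τx≈τy) (στ≈id y))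

      P : ℕ → Mat3 F
      P = prodFrom F σ M 0

    -- The τ-semilinear map whose fixed points are the solutions of w M = σ(w).
    S : Vector3 → Vector3
    S w = map τ (w ⋆ M)

    S-cong : ∀ {v w} → v ≋ w → S v ≋ S w
    S-cong v≋w j = τ.⟦⟧-cong (⋆-cong {M = M} v≋w (λ _ _ → refl) j)

    Sⁱ : ℕ → Vector3 → Vector3
    Sⁱ zero    w = w
    Sⁱ (suc k) w = Sⁱ k (S w)

    Sⁱ-cong : ∀ k {v w} → v ≋ w → Sⁱ k v ≋ Sⁱ k w
    Sⁱ-cong zero    v≋w = v≋w
    Sⁱ-cong (suc k) v≋w = Sⁱ-cong k (S-cong v≋w)

    S-Sⁱ : ∀ k w → S (Sⁱ k w) ≡ Sⁱ k (S w)
    S-Sⁱ zero    w = ≡.refl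
    S-Sⁱ (suc k) w = S-Sⁱ k (S w)

    Sⁱ≋ : ∀ k w → Sⁱ k w ≋ map (iter F τ k) (w ⋆ P k)
    Sⁱ≋ zero    w j = sym (⋆-identityʳ w j)
    Sⁱ≋ (suc k) w j = begin
      Sⁱ k (S w) j                                        ≈⟨ Sⁱ≋ k (S w) j ⟩
      iter F τ k ((S w ⋆ P k) j)                          ≈⟨ iter-cong τ.⟦⟧-cong k S-step ⟩
      iter F τ k (τ ((w ⋆ P (suc k)) j))                  ≡⟨ iter-suc τ k _ ⟨
      iter F τ (suc k) ((w ⋆ P (suc k)) j)                ∎
      where
      τσP≋P : mapMat F τ (prodFrom F σ M 1 k) ≋ₘ P k
      τσP≋P a b = trans (τ.⟦⟧-cong (prodFrom-suc σ-hom M 0 k a b)) (τσ≈id _)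
      S-step : (S w ⋆ P k) j ≈ τ ((w ⋆ P (suc k)) j)
      S-step = begin
        (S w ⋆ P k) j                                       ≈⟨ ⋆-cong {u = S w} (λ _ → refl) τσP≋P j ⟨
        (map τ (w ⋆ M) ⋆ mapMat F τ (prodFrom F σ M 1 k)) j ≈⟨ homo-⋆ τ-hom (w ⋆ M) (prodFrom F σ M 1 k) j ⟨
        τ ((w ⋆ M ⋆ prodFrom F σ M 1 k) j)                   ≈⟨ τ.⟦⟧-cong (⋆-⊗ w M (prodFrom F σ M 1 k) j) ⟨
        τ ((w ⋆ P (suc k)) j)                                ∎

    Sⁿ≋ : ∀ w → Sⁱ n w ≋ w ⋆ P n
    Sⁿ≋ w j = trans (Sⁱ≋ n w j) (proj₁ (hasOrder-leftInverse τ.⟦⟧-cong τσ≈id order) _)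

    S-sum : ∀ {k} (vs : Fin k → Vector3) → S (λ j → ∑[ i < k ] vs i j) ≋ (λ j → ∑[ i < k ] S (vs i) j)
    S-sum vs j = trans (τ.⟦⟧-cong (⋆-sum vs M j)) (homo-sum τ-hom (λ i → (vs i ⋆ M) j))

    Sⁱ-scale : ∀ k x w → Sⁱ k (map (x *_) w) ≋ map (iter F τ k x *_) (Sⁱ k w)
    Sⁱ-scale zero    x w j = refl
    Sⁱ-scale (suc k) x w j = begin
      Sⁱ k (S (map (x *_) w)) j              ≈⟨ Sⁱ-cong k S-scale j ⟩
      Sⁱ k (map (τ x *_) (S w)) j            ≈⟨ Sⁱ-scale k (τ x) (S w) j ⟩
      iter F τ k (τ x) * Sⁱ k (S w) j        ≡⟨ ≡.cong (_* _) (iter-suc τ k x) ⟨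
      iter F τ (suc k) x * Sⁱ k (S w) j      ∎
      where
      S-scale : S (map (x *_) w) ≋ map (τ x *_) (S w)
      S-scale j = trans (τ.⟦⟧-cong (⋆-scale x w M j)) (τ.*-homo x _)

    S-fixed⇒twisted : ∀ w → S w ≋ w → w ⋆ M ≋ map σ w
    S-fixed⇒twisted w Sw≋w j = trans (sym (στ≈id _)) (σ.⟦⟧-cong (Sw≋w j))

    -- For u fixed by P n, the trace Σᵢ Sⁱ(x u) is S-fixed, hence zero; by the
    -- independence of the characters τⁱ this forces u = 0.
    twisted-trivial⇒fixed-trivial : (∀ w → w ⋆ M ≋ map σ w → w ≋ 0ᵥ) → ∀ u → u ⋆ P n ≋ u → u ≋ 0ᵥ
    twisted-trivial⇒fixed-trivial twisted-trivial u u-fixed j =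
      characters-independent (λ i → iter F τ (toℕ i))
        (λ i → IsRingHomomorphism.*-homo (iter-isRingHomomorphism τ-hom (toℕ i)))
        (λ i → IsRingHomomorphism.1#-homo (iter-isRingHomomorphism τ-hom (toℕ i)))
        (hasOrder⇒iterates-distinct τ-injective (hasOrder-leftInverse τ.⟦⟧-cong τσ≈id order))
        (λ i → Sⁱ (toℕ i) u j) trace≈0 0F
      where
      term : Carrier → ℕ → Vector3
      term x k = Sⁱ k (map (x *_) u)

      trace : Carrier → Vector3
      trace x j = ∑[ i < n ] term x (toℕ i) j

      termⁿ≈term⁰ : ∀ x → term x n ≋ term x 0
      termⁿ≈term⁰ x j = trans (Sⁿ≋ (map (x *_) u) j) (trans (⋆-scale x u (P n) j) (*-congˡ (u-fixed j)))

      trace-S-fixed : ∀ x → S (trace x) ≋ trace x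
      trace-S-fixed x j = begin
        S (trace x) j                                ≈⟨ S-sum {n} (λ i → term x (toℕ i)) j ⟩
        ∑[ i < n ] S (term x (toℕ i)) j              ≡⟨ sum-cong-≗ {n} (λ i → ≡.cong (λ v → v j) (S-Sⁱ (toℕ i) (map (x *_) u))) ⟩
        ∑[ i < n ] term x (suc (toℕ i)) j            ≈⟨ sum-rotate n (λ k → term x k j) (termⁿ≈term⁰ x j) ⟩
        trace x j                                    ∎

      trace≈0 : ∀ x → ∑[ i < n ] (iter F τ (toℕ i) x * Sⁱ (toℕ i) u j) ≈ 0#
      trace≈0 x = begin
        ∑[ i < n ] (iter F τ (toℕ i) x * Sⁱ (toℕ i) u j) ≈⟨ sum-cong-≋ {n} (λ i → Sⁱ-scale (toℕ i) x u j) ⟨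
        trace x j                                        ≈⟨ twisted-trivial (trace x) (S-fixed⇒twisted _ (trace-S-fixed x)) j ⟩
        0#                                               ∎

  module Companion {σ} (σ-hom : IsRingHomomorphism σ) (a b c d : Carrier) (d≉0 : ¬ (d ≈ 0#)) where
    private
      module σ = IsRingHomomorphism σ-hom
      C′ : Mat3 F
      C′ = C F a b c d

    L : Carrier → Carrier
    L = Lmap F σ a b c d

    L-cong : ∀ {x y} → x ≈ y → L x ≈ L y
    L-cong x≈y = +-cong (+-cong (+-cong (*-congˡ x≈y) (*-congˡ (σ.⟦⟧-cong x≈y)))
                                (*-congˡ (σ.⟦⟧-cong (σ.⟦⟧-cong x≈y))))
                        (*-congˡ (σ.⟦⟧-cong (σ.⟦⟧-cong (σ.⟦⟧-cong x≈y))))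

    L-homo-‿ : ∀ x y → L (x - y) ≈ L x - L y
    L-homo-‿ x y = begin
      L (x - y)
        ≈⟨ +-cong (+-cong (+-congˡ (*-congˡ (σ-‿ 1))) (*-congˡ (σ-‿ 2))) (*-congˡ (σ-‿ 3)) ⟩
      a * (x - y) + b * (σ¹ x - σ¹ y) + c * (σ² x - σ² y) + d * (σ³ x - σ³ y)
        ≈⟨ linear a b c d x (σ¹ x) (σ² x) (σ³ x) y (σ¹ y) (σ² y) (σ³ y) ⟩
      L x - L y
        ∎
      where
      σ¹ σ² σ³ : Carrier → Carrier
      σ¹ = iter F σ 1
      σ² = iter F σ 2
      σ³ = iter F σ 3
      σ-‿ : ∀ k → iter F σ k (x - y) ≈ iter F σ k x - iter F σ k y
      σ-‿ k = trans (+-homo x (- y)) (+-congˡ (-‿homo y))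
        where open IsRingHomomorphism (iter-isRingHomomorphism σ-hom k) using (+-homo; -‿homo)
      linear : ∀ a b c d x₀ x₁ x₂ x₃ y₀ y₁ y₂ y₃ →
               a * (x₀ - y₀) + b * (x₁ - y₁) + c * (x₂ - y₂) + d * (x₃ - y₃)
               ≈ (a * x₀ + b * x₁ + c * x₂ + d * x₃) - (a * y₀ + b * y₁ + c * y₂ + d * y₃)
      linear = solve 12 (λ a b c d x₀ x₁ x₂ x₃ y₀ y₁ y₂ y₃ →
                   a :* (x₀ :+ :- y₀) :+ b :* (x₁ :+ :- y₁) :+ c :* (x₂ :+ :- y₂) :+ d :* (x₃ :+ :- y₃)
                := (a :* x₀ :+ b :* x₁ :+ c :* x₂ :+ d :* x₃) :+ :- (a :* y₀ :+ b :* y₁ :+ c :* y₂ :+ d :* y₃)) refl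

    L-0 : L 0# ≈ 0#
    L-0 = begin
      L 0#         ≈⟨ L-cong (-‿inverseʳ 0#) ⟨
      L (0# - 0#)  ≈⟨ L-homo-‿ 0# 0# ⟩
      L 0# - L 0#  ≈⟨ -‿inverseʳ (L 0#) ⟩
      0#           ∎

    kernel-trivial⇒injective : (∀ z → L z ≈ 0# → z ≈ 0#) → Injective _≈_ _≈_ L
    kernel-trivial⇒injective kernel-trivial {x} {y} Lx≈Ly =
      x∙y⁻¹≈ε⇒x≈y x y (kernel-trivial (x - y) (trans (L-homo-‿ x y) (x≈y⇒x∙y⁻¹≈ε Lx≈Ly)))

    orbit : Carrier → Vector3
    orbit z 0F = z
    orbit z 1F = σ z
    orbit z 2F = σ (σ z)

    ⋆C-shift₀ : ∀ w → (w ⋆ C′) 0F ≈ w 1F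
    ⋆C-shift₀ w = solve 3 (λ x y z → x :* con (0 , 0) :+ y :* con (1 , 0) :+ z :* con (0 , 0) := y) refl _ _ _

    ⋆C-shift₁ : ∀ w → (w ⋆ C′) 1F ≈ w 2F
    ⋆C-shift₁ w = solve 3 (λ x y z → x :* con (0 , 0) :+ y :* con (0 , 0) :+ z :* con (1 , 0) := z) refl _ _ _

    -- The last column of C′ is -(a, b, c)/d.
    ⋆C-last : ∀ w → a * w 0F + b * w 1F + c * w 2F + d * (w ⋆ C′) 2F ≈ 0#
    ⋆C-last w = begin
      a * w 0F + b * w 1F + c * w 2F + d * (w ⋆ C′) 2F  ≈⟨ expand a b c d (d ⁻¹) (w 0F) (w 1F) (w 2F) ⟩
      K - d * d ⁻¹ * K                                  ≈⟨ +-congˡ (-‿cong (trans (*-congʳ (inverseʳ d d≉0)) (*-identityˡ K))) ⟩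
      K - K                                             ≈⟨ -‿inverseʳ K ⟩
      0#                                                ∎
      where
      K : Carrier
      K = a * w 0F + b * w 1F + c * w 2F
      expand : ∀ a b c d d′ w₀ w₁ w₂ →
        a * w₀ + b * w₁ + c * w₂ + d * (w₀ * - (a * d′) + w₁ * - (b * d′) + w₂ * - (c * d′))
        ≈ (a * w₀ + b * w₁ + c * w₂) - d * d′ * (a * w₀ + b * w₁ + c * w₂)
      expand = solve 8 (λ a b c d d′ w₀ w₁ w₂ →
          a :* w₀ :+ b :* w₁ :+ c :* w₂ :+ d :* (w₀ :* :- (a :* d′) :+ w₁ :* :- (b :* d′) :+ w₂ :* :- (c :* d′))
        := (a :* w₀ :+ b :* w₁ :+ c :* w₂) :+ :- (d :* d′ :* (a :* w₀ :+ b :* w₁ :+ c :* w₂))) refl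

    kernel⇒twisted : ∀ z → L z ≈ 0# → orbit z ⋆ C′ ≋ map σ (orbit z)
    kernel⇒twisted z Lz≈0 0F = ⋆C-shift₀ (orbit z)
    kernel⇒twisted z Lz≈0 1F = ⋆C-shift₁ (orbit z)
    kernel⇒twisted z Lz≈0 2F = *-cancelˡ-nonZero d≉0 (+-cancelˡ (a * z + b * σ z + c * σ (σ z)) _ _
      (trans (⋆C-last (orbit z)) (sym Lz≈0)))

    twisted⇒orbit : ∀ w → w ⋆ C′ ≋ map σ w → w ≋ orbit (w 0F)
    twisted⇒orbit w twisted 0F = refl
    twisted⇒orbit w twisted 1F = trans (sym (⋆C-shift₀ w)) (twisted 0F)
    twisted⇒orbit w twisted 2F = trans (sym (⋆C-shift₁ w)) (trans (twisted 1F) (σ.⟦⟧-cong (twisted⇒orbit w twisted 1F)))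

    twisted⇒kernel : ∀ w → w ⋆ C′ ≋ map σ w → L (w 0F) ≈ 0#
    twisted⇒kernel w twisted = begin
      L (w 0F)                                               ≈⟨ +-cong (+-cong (+-congˡ (*-congˡ (sym (w≋orbit 1F)))) (*-congˡ (sym (w≋orbit 2F))))
                                                                       (*-congˡ (σ.⟦⟧-cong (sym (w≋orbit 2F)))) ⟩
      a * w 0F + b * w 1F + c * w 2F + d * σ (w 2F)          ≈⟨ +-congˡ (*-congˡ (twisted 2F)) ⟨
      a * w 0F + b * w 1F + c * w 2F + d * (w ⋆ C′) 2F       ≈⟨ ⋆C-last w ⟩
      0#                                                     ∎
      where
      w≋orbit : w ≋ orbit (w 0F)
      w≋orbit = twisted⇒orbit w twisted

    twisted-trivial : Injective _≈_ _≈_ L → ∀ w → w ⋆ C′ ≋ map σ w → w ≋ 0ᵥ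
    twisted-trivial L-injective w twisted j = trans (twisted⇒orbit w twisted j) (orbit-0 j)
      where
      w₀≈0 : w 0F ≈ 0#
      w₀≈0 = L-injective (trans (twisted⇒kernel w twisted) (sym L-0))
      orbit-0 : orbit (w 0F) ≋ 0ᵥ
      orbit-0 0F = w₀≈0
      orbit-0 1F = trans (σ.⟦⟧-cong w₀≈0) σ.0#-homo
      orbit-0 2F = trans (σ.⟦⟧-cong (orbit-0 1F)) σ.0#-homo

theorem15 : (F : Field) (q n : ℕ) → IsPrimePower q → n ≥ 1 →
    (σ : Field.Carrier F → Field.Carrier F) → IsGaloisGenerator F q n σ →
    (a b c d : Field.Carrier F) →
    ¬ (Field._≈_ F d (Field.0# F)) → ¬ (Field._≈_ F a (Field.0# F)) →
    IsPermutation F (Lmap F σ a b c d)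
      ⇔ (¬ (Field._≈_ F (Field._-_ F (Field._+_ F (Field._-_ F (Field.1# F) (χ₂ F (A F σ n a b c d))) (χ₁ F (A F σ n a b c d))) (χ₀ F (A F σ n a b c d))) (Field.0# F)))
theorem15 F q (suc m) _ _ σ galois a b c d d≉0 _ = mk⇔ permutation⇒χ[1]≉0 χ[1]≉0⇒permutation
  where
  open Field F
  open FieldTheory F
  open IsGaloisGenerator galois

  σ-hom : IsRingHomomorphism σ
  σ-hom = automorphism⇒isRingHomomorphism auto

  open Companion σ-hom a b c d d≉0
  open Descent σ-hom order (C F a b c d) using (twisted-trivial⇒fixed-trivial)

  A′ : Mat3 F
  A′ = A F σ (suc m) a b c d

  I-A : Mat3 F
  I-A i j = I3 F i j - A′ i j

  χ[1]≈det[I-A] : 1# - χ₂ F A′ + χ₁ F A′ - χ₀ F A′ ≈ det I-A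
  χ[1]≈det[I-A] = characteristicAtOne≈det[I-M] A′

  kernel⇒fixed : ∀ z → L z ≈ 0# → orbit z ⋆ A′ ≋ orbit z
  kernel⇒fixed z Lz≈0 j = trans (twisted-⋆prodFrom σ-hom _ _ (kernel⇒twisted z Lz≈0) (suc m) j) (proj₁ order _)

  permutation⇒χ[1]≉0 : IsPermutation F L → ¬ (1# - χ₂ F A′ + χ₁ F A′ - χ₀ F A′ ≈ 0#)
  permutation⇒χ[1]≉0 (L-injective , _) χ[1]≈0 =
    leftKernel-trivial⇒det≉0 I-A kernel-trivial (trans (sym χ[1]≈det[I-A]) χ[1]≈0)
    where
    kernel-trivial : ∀ u → u ⋆ I-A ≋ 0ᵥ → u ≋ 0ᵥ
    kernel-trivial u u⋆[I-A]≈0 =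
      twisted-trivial⇒fixed-trivial (twisted-trivial L-injective) u (⋆[I-M]≈0⇒fixed u A′ u⋆[I-A]≈0)

  χ[1]≉0⇒permutation : ¬ (1# - χ₂ F A′ + χ₁ F A′ - χ₀ F A′ ≈ 0#) → IsPermutation F L
  χ[1]≉0⇒permutation χ[1]≉0 = L-injective , finite-injective⇒surjective card L-cong L-injective
    where
    L-injective : Injective _≈_ _≈_ L
    L-injective = kernel-trivial⇒injective λ z Lz≈0 →
      det≉0⇒leftKernel-trivial I-A (λ det≈0 → χ[1]≉0 (trans χ[1]≈det[I-A] det≈0))
        (orbit z) (fixed⇒⋆[I-M]≈0 (orbit z) A′ (kernel⇒fixed z Lz≈0)) 0F
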